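{- Let $p$ be a prime and $a,l\in\mathbb{Z}$ with $l\ge2$. If $p^{l-1}\nmid 3a$, then $T_a(p^l)=0$.
   Context: $F_0(\mathbf{y})=y_1^3+y_2^3+y_3^3$, $F_a=F_0-a$, $e_n(t)=e^{2\pi it/n}$. $T_a(n)=\sum_{u\in(\mathbb{Z}/n\mathbb{Z})^\times}\sum_{\mathbf{y}\in(\mathbb{Z}/n\mathbb{Z})^3}e_n(uF_a(\mathbf{y}))$. -}

module Defs where

open import Level using (Level)
open import Data.Nat as ℕ using (ℕ; zero; suc; NonZero)
open import Data.Nat.Coprimality using (coprime?)
open import Data.Fin as F using (Fin; toℕ)
open import Data.Integer as ℤ using (ℤ; +_)
open import Data.Integer.Base using (_%ℕ_)
open import Data.Sum using (_⊎_)
open import Data.Product using () renaming (_×_ to _∧_)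
open import Relation.Nullary using (yes; no; ¬_)
open import Relation.Binary.PropositionalEquality using (_≡_)
open import Algebra.Bundles using (CommutativeRing; Semiring)
import Algebra.Definitions.RawSemiring as RS

F : ℤ → ℤ → ℤ → ℤ → ℤ
F a y₁ y₂ y₃ = y₁ ℤ.* y₁ ℤ.* y₁ ℤ.+ y₂ ℤ.* y₂ ℤ.* y₂ ℤ.+ y₃ ℤ.* y₃ ℤ.* y₃ ℤ.- a

module _ {c ℓ : Level} (R : CommutativeRing c ℓ) where
  open CommutativeRing R
  open RS (Semiring.rawSemiring semiring) using (_^_; _×_)

  sumFin : (n : ℕ) → (Fin n → Carrier) → Carrier
  sumFin zero    f = 0#
  sumFin (suc n) f = f F.zero + sumFin n (λ i → f (F.suc i))

  IsDomain : Set (c Level.⊔ ℓ)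
  IsDomain = (¬ (1# ≈ 0#)) ∧ (∀ x y → x * y ≈ 0# → x ≈ 0# ⊎ y ≈ 0#)

  CharZero : Set ℓ
  CharZero = ∀ m → m × 1# ≈ 0# → m ≡ 0

  IsPrimitivePrimePowerRoot : ℕ → ℕ → Carrier → Set ℓ
  IsPrimitivePrimePowerRoot p l ζ =
    (ζ ^ (p ℕ.^ l) ≈ 1#) ∧ (¬ (ζ ^ (p ℕ.^ (l ℕ.∸ 1)) ≈ 1#))

  -- e_n(t) realised as ζ^(t mod n), ζ a primitive n-th root of unity
  e : (n : ℕ) .{{_ : NonZero n}} → Carrier → ℤ → Carrier
  e n ζ t = ζ ^ (t %ℕ n)

  T : (n : ℕ) .{{_ : NonZero n}} → Carrier → ℤ → Carrier
  T n ζ a = sumFin n λ u → unitTerm (toℕ u) (sumFin n λ y₁ → sumFin n λ y₂ → sumFin n λ y₃ →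
              e n ζ (+ toℕ u ℤ.* F a (+ toℕ y₁) (+ toℕ y₂) (+ toℕ y₃)))
    where
    unitTerm : ℕ → Carrier → Carrier
    unitTerm u x with coprime? u n
    ... | yes _ = x
    ... | no _  = 0#

-- With G(u) = Σ_{y mod p^l} e(u y³), the inner sum of T_a(p^l) factorises as G(u)³ e(−u a).
-- G(u c³) = G(u) for every unit c, and for j ≥ m (m = 1 if p ≠ 3, m = 2 if p = 3) the cubes
-- (1 + p x)³ move u to u + p^j w modulo p^(j+1); descending from j ≥ l, where G is periodic,
-- this gives G(u + p^m w) = G(u) whenever p ∤ u.  Shifting the summation variable u by p^m
-- therefore multiplies T_a(p^l) by ξ = e(−p^m a), so in a domain T_a(p^l) = 0 or ξ = 1, and
-- ξ = 1 means p^l ∣ p^m a, which forces p^(l−1) ∣ 3a because p^m ∣ 3p.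

module Submission where

open import Defs

module ModularArithmetic where

  open import Data.Nat as ℕ using (ℕ; zero; suc; NonZero)
  import Data.Nat.Properties as ℕ
  open import Data.Nat.Divisibility as ℕ using (divides)
  open import Data.Nat.Coprimality using (Coprime; coprime-Bézout; coprime-divisor)
  open import Data.Nat.GCD using (module Bézout)
  open import Data.Nat.Primality using (Prime; prime?; euclidsLemma; prime⇒irreducible; prime⇒nonZero; prime⇒nonTrivial)
  open import Data.Integer as ℤ using (ℤ; +_; _+_; _*_; -_; _-_; ∣_∣)
  open import Data.Integer.Base using (_%ℕ_; _/ℕ_)
  import Data.Integer.Properties as ℤ
  open import Data.Integer.DivMod using (a≡a%ℕn+[a/ℕn]*n; n%ℕd<d)
  open import Data.Integer.Divisibility.Signed as ℤ∣ using (_∣_)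
  open import Data.Integer.Tactic.RingSolver using (solve)
  open import Data.Fin as Fin using (Fin; toℕ; fromℕ<)
  open import Data.Fin.Permutation using (Permutation′; permutation)
  import Data.Fin.Properties as Fin
  open import Data.List using (_∷_; [])
  open import Data.Product using (∃₂; ∃-syntax; _×_; _,_)
  open import Data.Sum using (_⊎_; inj₁; inj₂)
  open import Data.Empty using (⊥-elim)
  open import Relation.Nullary using (¬_; yes; no)
  open import Relation.Nullary.Decidable using (toWitness)
  open import Relation.Binary.PropositionalEquality
  open ≡-Reasoning

  InvertibleMod : ℕ → ℤ → Set
  InvertibleMod N c = ∃₂ λ c′ k → c * c′ ≡ + 1 + k * + N

  module Residue (N : ℕ) .{{_ : NonZero N}} where

    %ℕ-unique : ∀ {t r} q → r ℕ.< N → t ≡ + r + q * + N → t %ℕ N ≡ r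
    %ℕ-unique {t} {r} q r<N t≡r+qN = ℤ.+-injective (ℤ.i-j≡0⇒i≡j _ _ r₀-r≡0)
      where
      r₀ : ℕ
      r₀ = t %ℕ N
      q₀ : ℤ
      q₀ = t /ℕ N
      difference : ∀ x y a b n → x + a * n ≡ y + b * n → x - y ≡ (b - a) * n
      difference x y a b n eq = begin
        x - y                                   ≡⟨ solve (x ∷ y ∷ a ∷ b ∷ n ∷ []) ⟩
        (x + a * n) - (y + b * n) + (b - a) * n ≡⟨ cong (λ z → z - (y + b * n) + (b - a) * n) eq ⟩
        (y + b * n) - (y + b * n) + (b - a) * n ≡⟨ solve (y ∷ a ∷ b ∷ n ∷ []) ⟩
        (b - a) * n                             ∎
      r₀-r≡[q-q₀]N : + r₀ - + r ≡ (q - q₀) * + N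
      r₀-r≡[q-q₀]N = difference (+ r₀) (+ r) q₀ q (+ N) (trans (sym (a≡a%ℕn+[a/ℕn]*n t N)) t≡r+qN)
      ∣r₀-r∣<N : ∣ + r₀ - + r ∣ ℕ.< N
      ∣r₀-r∣<N = ℕ.≤-<-trans (subst (λ z → ∣ z ∣ ℕ.≤ r₀ ℕ.⊔ r) (sym (ℤ.m-n≡m⊖n r₀ r)) (ℤ.∣m⊝n∣≤m⊔n r₀ r))
                            (ℕ.⊔-lub (n%ℕd<d t N) r<N)
      ∣q-q₀∣≡0 : ∣ q - q₀ ∣ ≡ 0
      ∣q-q₀∣≡0 with ∣ q - q₀ ∣ | trans (cong ∣_∣ r₀-r≡[q-q₀]N) (ℤ.abs-* (q - q₀) (+ N))
      ... | zero  | _   = refl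
      ... | suc k | eq = ⊥-elim (ℕ.<⇒≱ ∣r₀-r∣<N (subst (N ℕ.≤_) (sym eq) (ℕ.m≤m+n N (k ℕ.* N))))
      r₀-r≡0 : + r₀ - + r ≡ + 0
      r₀-r≡0 = trans r₀-r≡[q-q₀]N (cong (_* + N) (ℤ.∣i∣≡0⇒i≡0 {q - q₀} ∣q-q₀∣≡0))

    residue : ℤ → Fin N
    residue t = fromℕ< (n%ℕd<d t N)

    residue-spec : ∀ t → t ≡ + toℕ (residue t) + t /ℕ N * + N
    residue-spec t = trans (a≡a%ℕn+[a/ℕn]*n t N) (cong (λ r → + r + t /ℕ N * + N) (sym (Fin.toℕ-fromℕ< _)))

    residue-value : ∀ t → + toℕ (residue t) ≡ t - t /ℕ N * + N
    residue-value t = trans (x≡x+y-y _ (t /ℕ N * + N)) (cong (_- t /ℕ N * + N) (sym (residue-spec t)))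
      where
      x≡x+y-y : ∀ x y → x ≡ x + y - y
      x≡x+y-y x y = solve (x ∷ y ∷ [])

    residue-unique : ∀ {t} (y : Fin N) q → t ≡ + toℕ y + q * + N → residue t ≡ y
    residue-unique y q eq = Fin.toℕ-injective (trans (Fin.toℕ-fromℕ< _) (%ℕ-unique q (Fin.toℕ<n y) eq))

    affinePermutation : ∀ c → InvertibleMod N c → ℤ → Permutation′ N
    affinePermutation c (c′ , k , cc′≡1+kN) s = permutation to from to∘from from∘to
      where
      to from : Fin N → Fin N
      to   y = residue (c * + toℕ y + s)
      from y = residue (c′ * (+ toℕ y - s))

      to∘from : ∀ y → to (from y) ≡ y
      to∘from y = residue-unique y (k * (+ toℕ y - s) - c * (t /ℕ N))
        (trans (cong (λ r → c * r + s) (residue-value t)) (cancel (+ toℕ y) (t /ℕ N) (+ N) cc′≡1+kN))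
        where
        t : ℤ
        t = c′ * (+ toℕ y - s)
        cancel : ∀ x q n → c * c′ ≡ + 1 + k * n → c * (c′ * (x - s) - q * n) + s ≡ x + (k * (x - s) - c * q) * n
        cancel x q n cc′≡1+kn = begin
          c * (c′ * (x - s) - q * n) + s          ≡⟨ solve (c ∷ c′ ∷ x ∷ s ∷ q ∷ n ∷ []) ⟩
          (c * c′) * (x - s) - c * q * n + s      ≡⟨ cong (λ z → z * (x - s) - c * q * n + s) cc′≡1+kn ⟩
          (+ 1 + k * n) * (x - s) - c * q * n + s ≡⟨ solve (k ∷ n ∷ x ∷ s ∷ c ∷ q ∷ []) ⟩
          x + (k * (x - s) - c * q) * n           ∎

      from∘to : ∀ y → from (to y) ≡ y
      from∘to y = residue-unique y (k * + toℕ y - c′ * (t /ℕ N))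
        (trans (cong (λ r → c′ * (r - s)) (residue-value t)) (cancel (+ toℕ y) (t /ℕ N) (+ N) cc′≡1+kN))
        where
        t : ℤ
        t = c * + toℕ y + s
        cancel : ∀ x q n → c * c′ ≡ + 1 + k * n → c′ * (c * x + s - q * n - s) ≡ x + (k * x - c′ * q) * n
        cancel x q n cc′≡1+kn = begin
          c′ * (c * x + s - q * n - s)    ≡⟨ solve (c ∷ c′ ∷ x ∷ s ∷ q ∷ n ∷ []) ⟩
          (c * c′) * x - c′ * q * n       ≡⟨ cong (λ z → z * x - c′ * q * n) cc′≡1+kn ⟩
          (+ 1 + k * n) * x - c′ * q * n  ≡⟨ solve (k ∷ n ∷ x ∷ c′ ∷ q ∷ []) ⟩
          x + (k * x - c′ * q) * n        ∎

    ∣%ℕ⇒∣ : ∀ {d t} → d ℕ.∣ N → d ℕ.∣ t %ℕ N → + d ∣ t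
    ∣%ℕ⇒∣ {d} {t} d∣N d∣r = subst (+ d ∣_) (sym (a≡a%ℕn+[a/ℕn]*n t N))
      (ℤ∣.∣m∣n⇒∣m+n {m = + (t %ℕ N)} (ℤ∣.∣ᵤ⇒∣ d∣r) (ℤ∣.∣n⇒∣m*n (t /ℕ N) (ℤ∣.∣ᵤ⇒∣ d∣N)))

  coprime⇒invertibleMod : ∀ N .{{_ : NonZero N}} c → Coprime (c %ℕ N) N → InvertibleMod N c
  coprime⇒invertibleMod N c cop with coprime-Bézout cop
  ... | Bézout.+- x y eq =
    + x , + y + q * + x , case₁ (+ (c %ℕ N)) q (+ N) (+ x) (+ y) (a≡a%ℕn+[a/ℕn]*n c N) (toℤ eq)
    where
    q : ℤ
    q = c /ℕ N
    toℤ : 1 ℕ.+ y ℕ.* N ≡ x ℕ.* (c %ℕ N) → + x * + (c %ℕ N) ≡ + 1 + + y * + N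
    toℤ eq = trans (sym (ℤ.pos-* x _))
                   (trans (cong +_ (sym eq)) (trans (ℤ.pos-+ 1 _) (cong (_+_ (+ 1)) (ℤ.pos-* y N))))
    case₁ : ∀ {c} r q n X Y → c ≡ r + q * n → X * r ≡ + 1 + Y * n → c * X ≡ + 1 + (Y + q * X) * n
    case₁ r q n X Y refl Xr≡1+Yn = begin
      (r + q * n) * X          ≡⟨ solve (r ∷ q ∷ n ∷ X ∷ []) ⟩
      X * r + q * X * n        ≡⟨ cong (_+ q * X * n) Xr≡1+Yn ⟩
      + 1 + Y * n + q * X * n  ≡⟨ solve (Y ∷ n ∷ q ∷ X ∷ []) ⟩
      + 1 + (Y + q * X) * n    ∎
  ... | Bézout.-+ x y eq =
    - + x , - + y - q * + x , case₂ (+ (c %ℕ N)) q (+ N) (+ x) (+ y) (a≡a%ℕn+[a/ℕn]*n c N) (toℤ eq)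
    where
    q : ℤ
    q = c /ℕ N
    toℤ : 1 ℕ.+ x ℕ.* (c %ℕ N) ≡ y ℕ.* N → + 1 + + x * + (c %ℕ N) ≡ + y * + N
    toℤ eq = trans (cong (_+_ (+ 1)) (sym (ℤ.pos-* x _)))
                   (trans (sym (ℤ.pos-+ 1 _)) (trans (cong +_ eq) (ℤ.pos-* y N)))
    case₂ : ∀ {c} r q n X Y → c ≡ r + q * n → + 1 + X * r ≡ Y * n → c * (- X) ≡ + 1 + (- Y - q * X) * n
    case₂ r q n X Y refl 1+Xr≡Yn = begin
      (r + q * n) * (- X)             ≡⟨ solve (r ∷ q ∷ n ∷ X ∷ []) ⟩
      + 1 - (+ 1 + X * r) - q * X * n ≡⟨ cong (λ z → + 1 - z - q * X * n) 1+Xr≡Yn ⟩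
      + 1 - Y * n - q * X * n         ≡⟨ solve (Y ∷ n ∷ q ∷ X ∷ []) ⟩
      + 1 + (- Y - q * X) * n         ∎

  prime[3] : Prime 3
  prime[3] = toWitness {a? = prime? 3} _

  module _ {p : ℕ} (pr : Prime p) where

    private instance
      p≢0 : NonZero p
      p≢0 = prime⇒nonZero pr

    ¬∣⇒coprime : ∀ {n} → ¬ p ℕ.∣ n → Coprime n p
    ¬∣⇒coprime ¬p∣n (d∣n , d∣p) with prime⇒irreducible pr d∣p
    ... | inj₁ d≡1 = d≡1
    ... | inj₂ refl = ⊥-elim (¬p∣n d∣n)

    ¬∣⇒coprime-^ : ∀ {n} e → ¬ p ℕ.∣ n → Coprime n (p ℕ.^ e)
    ¬∣⇒coprime-^ zero    _     (_ , d∣1) = ℕ.∣1⇒≡1 d∣1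
    ¬∣⇒coprime-^ (suc e) ¬p∣n {d} (d∣n , d∣p^[1+e]) =
      ¬∣⇒coprime-^ e ¬p∣n (d∣n , coprime-divisor d⊥p d∣p^[1+e])
      where
      d⊥p : Coprime d p
      d⊥p (f∣d , f∣p) = ¬∣⇒coprime ¬p∣n (ℕ.∣-trans f∣d d∣n , f∣p)

    ∣p^[1+k]⇒∣p^k⊎≡p^[1+k] : ∀ {g} k → g ℕ.∣ p ℕ.^ suc k → g ℕ.∣ p ℕ.^ k ⊎ g ≡ p ℕ.^ suc k
    ∣p^[1+k]⇒∣p^k⊎≡p^[1+k] {g} k (divides q p^[1+k]≡qg) with p ℕ.∣? q
    ... | yes (divides q′ refl) = inj₁ (divides q′ (ℕ.*-cancelˡ-≡ _ _ p (trans p^[1+k]≡qg q′pg≡p[q′g])))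
      where
      q′pg≡p[q′g] : q′ ℕ.* p ℕ.* g ≡ p ℕ.* (q′ ℕ.* g)
      q′pg≡p[q′g] = trans (cong (ℕ._* g) (ℕ.*-comm q′ p)) (ℕ.*-assoc p q′ g)
    ... | no ¬p∣q = inj₂ (sym (trans p^[1+k]≡qg (trans (cong (ℕ._* g) q≡1) (ℕ.*-identityˡ g))))
      where
      q≡1 : q ≡ 1
      q≡1 = ℕ.∣1⇒≡1 (coprime-divisor (¬∣⇒coprime-^ (suc k) ¬p∣q)
              (divides g (trans (ℕ.*-identityʳ _) (trans p^[1+k]≡qg (ℕ.*-comm q g)))))

    ¬∣⇒invertibleMod-p^ : ∀ {c} e → ¬ (+ p ∣ c) → InvertibleMod (p ℕ.^ suc e) c
    ¬∣⇒invertibleMod-p^ {c} e ¬p∣c = coprime⇒invertibleMod N c (¬∣⇒coprime-^ (suc e) ¬p∣r)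
      where
      N : ℕ
      N = p ℕ.^ suc e
      instance
        N≢0 : NonZero N
        N≢0 = ℕ.m^n≢0 p (suc e)
      ¬p∣r : ¬ p ℕ.∣ c %ℕ N
      ¬p∣r p∣r = ¬p∣c (Residue.∣%ℕ⇒∣ N (ℕ.m∣m*n (p ℕ.^ e)) p∣r)

    ¬∣⇒invertibleMod-p : ∀ {c} → ¬ (+ p ∣ c) → InvertibleMod p c
    ¬∣⇒invertibleMod-p {c} ¬p∣c = subst (λ n → InvertibleMod n c) (ℕ.*-identityʳ p) (¬∣⇒invertibleMod-p^ 0 ¬p∣c)

    ¬∣1+p* : ∀ x → ¬ (+ p ∣ + 1 + + p * x)
    ¬∣1+p* x p∣1+px = ℕ.nonTrivial⇒≢1 {{prime⇒nonTrivial pr}}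
      (ℕ.∣1⇒≡1 (ℤ∣.∣⇒∣ᵤ (ℤ∣.∣m+n∣n⇒∣m {m = + 1} p∣1+px (ℤ∣.∣m⇒∣m*n x (ℤ∣.∣-refl {+ p})))))

    ¬∣⇒¬∣3* : p ≢ 3 → ∀ {u} → ¬ (+ p ∣ u) → ¬ (+ p ∣ + 3 * u)
    ¬∣⇒¬∣3* p≢3 {u} ¬p∣u p∣3u with euclidsLemma 3 ∣ u ∣ pr (subst (p ℕ.∣_) (ℤ.abs-* (+ 3) u) (ℤ∣.∣⇒∣ᵤ p∣3u))
    ... | inj₂ p∣u = ¬p∣u (ℤ∣.∣ᵤ⇒∣ p∣u)
    ... | inj₁ p∣3 with prime⇒irreducible prime[3] p∣3
    ...   | inj₁ p≡1 = ℕ.nonTrivial⇒≢1 {{prime⇒nonTrivial pr}} p≡1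
    ...   | inj₂ p≡3 = p≢3 p≡3

    p^[1+k]∣p^m*a⇒p^k∣3*a : ∀ k m a → p ℕ.^ m ℕ.∣ 3 ℕ.* p → p ℕ.^ suc k ℕ.∣ p ℕ.^ m ℕ.* a → p ℕ.^ k ℕ.∣ 3 ℕ.* a
    p^[1+k]∣p^m*a⇒p^k∣3*a k m a p^m∣3p p^[1+k]∣p^m*a = ℕ.*-cancelˡ-∣ p
      (ℕ.∣-trans p^[1+k]∣p^m*a (ℕ.∣-trans (ℕ.*-monoˡ-∣ a p^m∣3p) (ℕ.∣-reflexive 3pa≡p[3a])))
      where
      3pa≡p[3a] : 3 ℕ.* p ℕ.* a ≡ p ℕ.* (3 ℕ.* a)
      3pa≡p[3a] = trans (cong (ℕ._* a) (ℕ.*-comm 3 p)) (ℕ.*-assoc p 3 a)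

  +^-suc : ∀ p i → + (p ℕ.^ suc i) ≡ + p * + (p ℕ.^ i)
  +^-suc p i = ℤ.pos-* p (p ℕ.^ i)

  CubesLiftFrom : ℕ → ℕ → Set
  CubesLiftFrom p m = ∀ j → m ℕ.≤ j → ∀ u w → ¬ (+ p ∣ u) →
    ∃₂ λ x Q → let c = + 1 + + p * x in u * (c * c * c) ≡ u + + (p ℕ.^ j) * w + + (p ℕ.^ suc j) * Q

  cubesLiftFrom-1 : ∀ {p} → Prime p → p ≢ 3 → CubesLiftFrom p 1
  cubesLiftFrom-1 _ _ zero ()
  cubesLiftFrom-1 {p} pr p≢3 (suc i) _ u w ¬p∣u with ¬∣⇒invertibleMod-p pr (¬∣⇒¬∣3* pr p≢3 ¬p∣u)
  ... | Y , K , 3uY≡1+Kp = + (p ℕ.^ i) * (Y * w) , Q ,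
    trans (expand u w (+ p) (+ (p ℕ.^ i)) Y K 3uY≡1+Kp)
          (cong₂ (λ s t → u + s * w + t * Q) (sym (+^-suc p i))
                 (sym (trans (+^-suc p (suc i)) (cong (+ p *_) (+^-suc p i)))))
    where
    Q : ℤ
    Q = K * w + + 3 * + (p ℕ.^ i) * (Y * w) * (Y * w) * u
              + + p * + (p ℕ.^ i) * + (p ℕ.^ i) * (Y * w) * (Y * w) * (Y * w) * u
    expand : ∀ u w q P Y K → + 3 * u * Y ≡ + 1 + K * q →
      let c = + 1 + q * (P * (Y * w)) in
      u * (c * c * c) ≡ u + (q * P) * w + (q * (q * P)) * (K * w + + 3 * P * (Y * w) * (Y * w) * u
                                                                + q * P * P * (Y * w) * (Y * w) * (Y * w) * u)
    expand u w q P Y K 3uY≡1+Kq = begin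
      u * ((+ 1 + q * (P * (Y * w))) * (+ 1 + q * (P * (Y * w))) * (+ 1 + q * (P * (Y * w))))
        ≡⟨ solve (u ∷ w ∷ q ∷ P ∷ Y ∷ []) ⟩
      u + (+ 3 * u * Y) * (q * P * w)
        + (q * (q * P)) * (+ 3 * P * (Y * w) * (Y * w) * u + q * P * P * (Y * w) * (Y * w) * (Y * w) * u)
        ≡⟨ cong (λ z → u + z * (q * P * w) + _) 3uY≡1+Kq ⟩
      u + (+ 1 + K * q) * (q * P * w)
        + (q * (q * P)) * (+ 3 * P * (Y * w) * (Y * w) * u + q * P * P * (Y * w) * (Y * w) * (Y * w) * u)
        ≡⟨ solve (u ∷ w ∷ q ∷ P ∷ Y ∷ K ∷ []) ⟩
      u + (q * P) * w + (q * (q * P)) * (K * w + + 3 * P * (Y * w) * (Y * w) * u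
                                              + q * P * P * (Y * w) * (Y * w) * (Y * w) * u) ∎

  -- For p = 3 the linear term of (1 + 3y)³ is 9y, so lifting only starts at j = 2.
  cubesLiftFrom-2 : CubesLiftFrom 3 2
  cubesLiftFrom-2 (suc zero) (ℕ.s≤s ())
  cubesLiftFrom-2 (suc (suc i)) _ u w ¬3∣u with ¬∣⇒invertibleMod-p prime[3] ¬3∣u
  ... | X , K , uX≡1+3K = + (3 ℕ.^ i) * (X * w) , Q ,
    trans (expand u w (+ (3 ℕ.^ i)) X K uX≡1+3K)
          (cong₂ (λ s t → u + s * w + t * Q) (sym +3^[2+i])
                 (sym (trans (+^-suc 3 (suc (suc i))) (cong (+ 3 *_) +3^[2+i]))))
    where
    +3^[2+i] : + (3 ℕ.^ suc (suc i)) ≡ + 3 * (+ 3 * + (3 ℕ.^ i))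
    +3^[2+i] = trans (+^-suc 3 (suc i)) (cong (+ 3 *_) (+^-suc 3 i))
    Q : ℤ
    Q = K * w + + (3 ℕ.^ i) * (X * w) * (X * w) * u + + (3 ℕ.^ i) * + (3 ℕ.^ i) * (X * w) * (X * w) * (X * w) * u
    expand : ∀ u w P X K → u * X ≡ + 1 + K * + 3 →
      let c = + 1 + + 3 * (P * (X * w)) in
      u * (c * c * c) ≡ u + (+ 3 * (+ 3 * P)) * w + (+ 3 * (+ 3 * (+ 3 * P))) * (K * w + P * (X * w) * (X * w) * u
                                                                            + P * P * (X * w) * (X * w) * (X * w) * u)
    expand u w P X K uX≡1+3K = begin
      u * ((+ 1 + + 3 * (P * (X * w))) * (+ 1 + + 3 * (P * (X * w))) * (+ 1 + + 3 * (P * (X * w))))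
        ≡⟨ solve (u ∷ w ∷ P ∷ X ∷ []) ⟩
      u + (u * X) * (+ 9 * P * w)
        + + 27 * P * (P * (X * w) * (X * w) * u + P * P * (X * w) * (X * w) * (X * w) * u)
        ≡⟨ cong (λ z → u + z * (+ 9 * P * w) + _) uX≡1+3K ⟩
      u + (+ 1 + K * + 3) * (+ 9 * P * w)
        + + 27 * P * (P * (X * w) * (X * w) * u + P * P * (X * w) * (X * w) * (X * w) * u)
        ≡⟨ solve (u ∷ w ∷ P ∷ X ∷ K ∷ []) ⟩
      u + (+ 3 * (+ 3 * P)) * w + (+ 3 * (+ 3 * (+ 3 * P))) * (K * w + P * (X * w) * (X * w) * u
                                                                + P * P * (X * w) * (X * w) * (X * w) * u) ∎

  liftingExponent : ∀ {p} → Prime p → ∃[ m ] (1 ℕ.≤ m × CubesLiftFrom p m × p ℕ.^ m ℕ.∣ 3 ℕ.* p)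
  liftingExponent {p} pr with p ℕ.≟ 3
  ... | yes refl = 2 , ℕ.s≤s ℕ.z≤n , cubesLiftFrom-2 , ℕ.∣-refl
  ... | no p≢3   = 1 , ℕ.≤-refl , cubesLiftFrom-1 pr p≢3 ,
                   ℕ.∣-trans (ℕ.∣-reflexive (ℕ.*-identityʳ p)) (ℕ.n∣m*n 3)

open ModularArithmetic

open import Level using (Level)
open import Data.Nat as ℕ using (ℕ; zero; suc; NonZero)
import Data.Nat.Properties as ℕ
import Data.Nat.DivMod as ℕ
open import Data.Nat.Divisibility as ℕ using (divides)
open import Data.Nat.GCD using (gcd; gcd-GCD; gcd[m,n]∣m; gcd[m,n]∣n; module Bézout)
open import Data.Nat.Primality using (Prime; prime⇒nonZero; prime⇒nonTrivial)
open import Data.Nat.Coprimality using (coprime?)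
open import Data.Integer.Divisibility.Signed as ℤ∣ using ()
open import Data.Integer as ℤ using (ℤ; +_)
open import Data.Integer.Base using (_%ℕ_; _/ℕ_)
import Data.Integer.Properties as ℤ
open import Data.Integer.DivMod using (a≡a%ℕn+[a/ℕn]*n)
open import Data.Integer.Tactic.RingSolver using (solve)
open import Data.Fin as Fin using (Fin; toℕ)
open import Data.Fin.Permutation using (Permutation′; _⟨$⟩ʳ_)
open import Data.List using (_∷_; [])
open import Data.Product using (_,_; proj₁; proj₂)
open import Data.Sum as Sum using (_⊎_; inj₁; inj₂)
open import Data.Empty using (⊥-elim)
open import Relation.Nullary using (¬_; yes; no)
import Relation.Binary.PropositionalEquality as ≡
open ≡ using (_≡_)
open import Algebra.Bundles using (CommutativeRing; Semiring)

module _ {c ℓ : Level} (R : CommutativeRing c ℓ) where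
  open CommutativeRing R
  open import Algebra.Definitions.RawSemiring (Semiring.rawSemiring semiring) using (_^_)
  open import Algebra.Properties.Semiring.Exp semiring using (^-homo-*; ^-assocʳ; ^-congˡ)
  open import Algebra.Properties.Semiring.Sum semiring using (sum; sum-cong-≋; sum-permute; *-distribˡ-sum; *-distribʳ-sum)
  open import Algebra.Properties.Ring ring using (x∙y⁻¹≈ε⇒x≈y; x≈y⇒x∙y⁻¹≈ε; x[y-z]≈xy-xz)
  open import Relation.Binary.Reasoning.Setoid setoid

  sumFin≡sum : ∀ n f → sumFin R n f ≡ sum f
  sumFin≡sum zero    f = ≡.refl
  sumFin≡sum (suc n) f = ≡.cong (_+_ (f Fin.zero)) (sumFin≡sum n (λ i → f (Fin.suc i)))

  sumFin-cong : ∀ n {f g} → (∀ i → f i ≈ g i) → sumFin R n f ≈ sumFin R n g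
  sumFin-cong n {f} {g} f≈g = begin
    sumFin R n f ≡⟨ sumFin≡sum n f ⟩
    sum f        ≈⟨ sum-cong-≋ f≈g ⟩
    sum g        ≡⟨ sumFin≡sum n g ⟨
    sumFin R n g ∎

  sumFin-distribˡ : ∀ n x f → sumFin R n (λ i → x * f i) ≈ x * sumFin R n f
  sumFin-distribˡ n x f = begin
    sumFin R n (λ i → x * f i) ≡⟨ sumFin≡sum n _ ⟩
    sum (λ i → x * f i)        ≈⟨ *-distribˡ-sum x f ⟨
    x * sum f                  ≡⟨ ≡.cong (x *_) (sumFin≡sum n f) ⟨
    x * sumFin R n f           ∎

  sumFin-distribʳ : ∀ n f x → sumFin R n (λ i → f i * x) ≈ sumFin R n f * x
  sumFin-distribʳ n f x = begin
    sumFin R n (λ i → f i * x) ≡⟨ sumFin≡sum n _ ⟩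
    sum (λ i → f i * x)        ≈⟨ *-distribʳ-sum x f ⟨
    sum f * x                  ≡⟨ ≡.cong (_* x) (sumFin≡sum n f) ⟨
    sumFin R n f * x           ∎

  sumFin-permute : ∀ n f (π : Permutation′ n) → sumFin R n (λ i → f (π ⟨$⟩ʳ i)) ≈ sumFin R n f
  sumFin-permute n f π = begin
    sumFin R n (λ i → f (π ⟨$⟩ʳ i)) ≡⟨ sumFin≡sum n _ ⟩
    sum (λ i → f (π ⟨$⟩ʳ i))        ≈⟨ sum-permute f π ⟨
    sum f                           ≡⟨ sumFin≡sum n f ⟨
    sumFin R n f                    ∎

  sumFin³-* : ∀ n f g h → sumFin R n (λ i → sumFin R n (λ j → sumFin R n (λ k → f i * g j * h k)))
                         ≈ sumFin R n f * sumFin R n g * sumFin R n h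
  sumFin³-* n f g h = begin
    sumFin R n (λ i → sumFin R n (λ j → sumFin R n (λ k → f i * g j * h k)))
      ≈⟨ sumFin-cong n (λ i → sumFin-cong n (λ j → sumFin-distribˡ n (f i * g j) h)) ⟩
    sumFin R n (λ i → sumFin R n (λ j → f i * g j * H))
      ≈⟨ sumFin-cong n (λ i → trans (sumFin-distribʳ n (λ j → f i * g j) H) (*-congʳ (sumFin-distribˡ n (f i) g))) ⟩
    sumFin R n (λ i → f i * G * H)
      ≈⟨ trans (sumFin-distribʳ n (λ i → f i * G) H) (*-congʳ (sumFin-distribʳ n f G)) ⟩
    sumFin R n f * G * H ∎
    where
    G H : Carrier
    G = sumFin R n g
    H = sumFin R n h

  x≈x*y⇒x≈0⊎y≈1 : IsDomain R → ∀ {x y} → x ≈ x * y → x ≈ 0# ⊎ y ≈ 1#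
  x≈x*y⇒x≈0⊎y≈1 (_ , noZeroDivisors) {x} {y} x≈xy =
    Sum.map₂ (λ 1-y≈0 → sym (x∙y⁻¹≈ε⇒x≈y 1# y 1-y≈0)) (noZeroDivisors x (1# - y) x[1-y]≈0)
    where
    x[1-y]≈0 : x * (1# - y) ≈ 0#
    x[1-y]≈0 = begin
      x * (1# - y)     ≈⟨ x[y-z]≈xy-xz x 1# y ⟩
      x * 1# - x * y   ≈⟨ +-congʳ (*-identityʳ x) ⟩
      x - x * y        ≈⟨ x≈y⇒x∙y⁻¹≈ε x≈xy ⟩
      0#               ∎

  -- The unit indicator in T is local to its definition, so T's summand is named by unification.
  summandOf : ∀ {n x} {f : Fin n → Carrier} → x ≡ sumFin R n f → Fin n → Carrier
  summandOf {f = f} _ = f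

  module _ (N : ℕ) .{{_ : NonZero N}} where
    open Residue N

    Periodic : (ℤ → Carrier) → Set ℓ
    Periodic f = ∀ t k → f (t ℤ.+ k ℤ.* + N) ≈ f t

    periodic-residue : ∀ {f} → Periodic f → ∀ t → f (+ toℕ (residue t)) ≈ f t
    periodic-residue {f} f-per t =
      sym (trans (reflexive (≡.cong f (residue-spec t))) (f-per (+ toℕ (residue t)) (t /ℕ N)))

    sumFin-affine : ∀ {f} → Periodic f → ∀ c → InvertibleMod N c → ∀ s →
      sumFin R N (λ y → f (c ℤ.* + toℕ y ℤ.+ s)) ≈ sumFin R N (λ y → f (+ toℕ y))
    sumFin-affine {f} f-per c c-inv s = begin
      sumFin R N (λ y → f (c ℤ.* + toℕ y ℤ.+ s))
        ≈⟨ sumFin-cong N (λ y → sym (periodic-residue f-per (c ℤ.* + toℕ y ℤ.+ s))) ⟩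
      sumFin R N (λ y → f (+ toℕ (affinePermutation c c-inv s ⟨$⟩ʳ y)))
        ≈⟨ sumFin-permute N (λ y → f (+ toℕ y)) (affinePermutation c c-inv s) ⟩
      sumFin R N (λ y → f (+ toℕ y)) ∎

  1^n≈1 : ∀ n → 1# ^ n ≈ 1#
  1^n≈1 zero    = refl
  1^n≈1 (suc n) = trans (*-identityˡ _) (1^n≈1 n)

  ^≈1-∣ : ∀ {x m n} → x ^ m ≈ 1# → m ℕ.∣ n → x ^ n ≈ 1#
  ^≈1-∣ {x} {m} xᵐ≈1 (divides q ≡.refl) = begin
    x ^ (q ℕ.* m) ≡⟨ ≡.cong (x ^_) (ℕ.*-comm q m) ⟩
    x ^ (m ℕ.* q) ≈⟨ ^-assocʳ x m q ⟨
    (x ^ m) ^ q   ≈⟨ ^-congˡ q xᵐ≈1 ⟩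
    1# ^ q        ≈⟨ 1^n≈1 q ⟩
    1#            ∎

  ^≈1-cancel : ∀ {x} d e → x ^ (d ℕ.+ e) ≈ 1# → x ^ e ≈ 1# → x ^ d ≈ 1#
  ^≈1-cancel {x} d e xᵈ⁺ᵉ≈1 xᵉ≈1 = begin
    x ^ d           ≈⟨ *-identityʳ _ ⟨
    x ^ d * 1#      ≈⟨ *-congˡ xᵉ≈1 ⟨
    x ^ d * x ^ e   ≈⟨ ^-homo-* x d e ⟨
    x ^ (d ℕ.+ e)   ≈⟨ xᵈ⁺ᵉ≈1 ⟩
    1#              ∎

  ^≈1-gcd : ∀ {x} m n → x ^ m ≈ 1# → x ^ n ≈ 1# → x ^ gcd m n ≈ 1#
  ^≈1-gcd {x} m n xᵐ≈1 xⁿ≈1 with Bézout.identity (gcd-GCD m n)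
  ... | Bézout.+- a b d+bn≡am = ^≈1-cancel (gcd m n) (b ℕ.* n)
          (trans (reflexive (≡.cong (x ^_) d+bn≡am)) (^≈1-∣ xᵐ≈1 (ℕ.n∣m*n a))) (^≈1-∣ xⁿ≈1 (ℕ.n∣m*n b))
  ... | Bézout.-+ a b d+am≡bn = ^≈1-cancel (gcd m n) (a ℕ.* m)
          (trans (reflexive (≡.cong (x ^_) d+am≡bn)) (^≈1-∣ xⁿ≈1 (ℕ.n∣m*n b))) (^≈1-∣ xᵐ≈1 (ℕ.n∣m*n a))

  ^≈1⇒p^[1+k]∣ : ∀ {p x k n} → Prime p →
    x ^ (p ℕ.^ suc k) ≈ 1# → ¬ x ^ (p ℕ.^ k) ≈ 1# → x ^ n ≈ 1# → p ℕ.^ suc k ℕ.∣ n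
  ^≈1⇒p^[1+k]∣ {p} {x} {k} {n} pr x^p^[1+k]≈1 x^p^k≉1 xⁿ≈1
    with ∣p^[1+k]⇒∣p^k⊎≡p^[1+k] pr k (gcd[m,n]∣n n (p ℕ.^ suc k))
  ... | inj₁ g∣p^k = ⊥-elim (x^p^k≉1 (^≈1-∣ (^≈1-gcd n (p ℕ.^ suc k) xⁿ≈1 x^p^[1+k]≈1) g∣p^k))
  ... | inj₂ g≡p^[1+k] = ≡.subst (ℕ._∣ n) g≡p^[1+k] (gcd[m,n]∣m n (p ℕ.^ suc k))

  x^n≈x^[n%N] : ∀ {x N} .{{_ : NonZero N}} → x ^ N ≈ 1# → ∀ n → x ^ n ≈ x ^ (n ℕ.% N)
  x^n≈x^[n%N] {x} {N} xᴺ≈1 n = begin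
    x ^ n                                ≡⟨ ≡.cong (x ^_) (ℕ.m≡m%n+[m/n]*n n N) ⟩
    x ^ (n ℕ.% N ℕ.+ (n ℕ./ N) ℕ.* N)     ≈⟨ ^-homo-* x (n ℕ.% N) ((n ℕ./ N) ℕ.* N) ⟩
    x ^ (n ℕ.% N) * x ^ ((n ℕ./ N) ℕ.* N) ≈⟨ *-congˡ (^≈1-∣ xᴺ≈1 (ℕ.n∣m*n (n ℕ./ N))) ⟩
    x ^ (n ℕ.% N) * 1#                    ≈⟨ *-identityʳ _ ⟩
    x ^ (n ℕ.% N)                         ∎

  module Character (N : ℕ) .{{_ : NonZero N}} (ζ : Carrier) (ζᴺ≈1 : ζ ^ N ≈ 1#) where
    open Residue N using (%ℕ-unique)

    e-pow : ∀ {t} r q → t ≡ + r ℤ.+ q ℤ.* + N → e R N ζ t ≈ ζ ^ r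
    e-pow {t} r q t≡r+qN = begin
      ζ ^ (t %ℕ N)  ≡⟨ ≡.cong (ζ ^_) (%ℕ-unique (q ℤ.+ + (r ℕ./ N)) (ℕ.m%n<n r N) t≡r%N+q′N) ⟩
      ζ ^ (r ℕ.% N) ≈⟨ x^n≈x^[n%N] ζᴺ≈1 r ⟨
      ζ ^ r         ∎
      where
      regroup : ∀ a b q n → a ℤ.+ b ℤ.* n ℤ.+ q ℤ.* n ≡ a ℤ.+ (q ℤ.+ b) ℤ.* n
      regroup a b q n = solve (a ∷ b ∷ q ∷ n ∷ [])
      t≡r%N+q′N : t ≡ + (r ℕ.% N) ℤ.+ (q ℤ.+ + (r ℕ./ N)) ℤ.* + N
      t≡r%N+q′N = ≡.trans t≡r+qN (≡.trans
        (≡.cong (λ z → z ℤ.+ q ℤ.* + N) (≡.trans (≡.cong +_ (ℕ.m≡m%n+[m/n]*n r N))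
          (≡.trans (ℤ.pos-+ (r ℕ.% N) _) (≡.cong (ℤ._+_ (+ (r ℕ.% N))) (ℤ.pos-* (r ℕ./ N) N)))))
        (regroup (+ (r ℕ.% N)) (+ (r ℕ./ N)) q (+ N)))

    e-homo : ∀ s t → e R N ζ (s ℤ.+ t) ≈ e R N ζ s * e R N ζ t
    e-homo s t = trans (e-pow (s %ℕ N ℕ.+ t %ℕ N) (s /ℕ N ℤ.+ t /ℕ N) s+t≡) (^-homo-* ζ (s %ℕ N) (t %ℕ N))
      where
      regroup : ∀ a b x y n → (a ℤ.+ x ℤ.* n) ℤ.+ (b ℤ.+ y ℤ.* n) ≡ a ℤ.+ b ℤ.+ (x ℤ.+ y) ℤ.* n
      regroup a b x y n = solve (a ∷ b ∷ x ∷ y ∷ n ∷ [])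
      s+t≡ : s ℤ.+ t ≡ + (s %ℕ N ℕ.+ t %ℕ N) ℤ.+ (s /ℕ N ℤ.+ t /ℕ N) ℤ.* + N
      s+t≡ = ≡.trans (≡.cong₂ ℤ._+_ (a≡a%ℕn+[a/ℕn]*n s N) (a≡a%ℕn+[a/ℕn]*n t N))
        (≡.trans (regroup (+ (s %ℕ N)) (+ (t %ℕ N)) (s /ℕ N) (t /ℕ N) (+ N))
                 (≡.cong (ℤ._+ (s /ℕ N ℤ.+ t /ℕ N) ℤ.* + N) (≡.sym (ℤ.pos-+ (s %ℕ N) (t %ℕ N)))))

    e-periodic : ∀ t k → e R N ζ (t ℤ.+ k ℤ.* + N) ≈ e R N ζ t
    e-periodic t k = e-pow (t %ℕ N) (t /ℕ N ℤ.+ k)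
      (≡.trans (≡.cong (ℤ._+ k ℤ.* + N) (a≡a%ℕn+[a/ℕn]*n t N)) (regroup (+ (t %ℕ N)) (t /ℕ N) k (+ N)))
      where
      regroup : ∀ a q k n → a ℤ.+ q ℤ.* n ℤ.+ k ℤ.* n ≡ a ℤ.+ (q ℤ.+ k) ℤ.* n
      regroup a q k n = solve (a ∷ q ∷ k ∷ n ∷ [])

    e-cong : ∀ {s t} → s ≡ t → e R N ζ s ≈ e R N ζ t
    e-cong s≡t = reflexive (≡.cong (e R N ζ) s≡t)

    cubicGaussSum : ℤ → Carrier
    cubicGaussSum u = sumFin R N λ y → e R N ζ (u ℤ.* (+ toℕ y ℤ.* + toℕ y ℤ.* + toℕ y))

    cubicGaussSum-periodic : ∀ u k → cubicGaussSum (u ℤ.+ k ℤ.* + N) ≈ cubicGaussSum u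
    cubicGaussSum-periodic u k = sumFin-cong N λ y → let t = + toℕ y in
      trans (e-cong (expand u k (+ N) t)) (e-periodic (u ℤ.* (t ℤ.* t ℤ.* t)) (k ℤ.* (t ℤ.* t ℤ.* t)))
      where
      expand : ∀ u k n t → (u ℤ.+ k ℤ.* n) ℤ.* (t ℤ.* t ℤ.* t) ≡ u ℤ.* (t ℤ.* t ℤ.* t) ℤ.+ k ℤ.* (t ℤ.* t ℤ.* t) ℤ.* n
      expand u k n t = solve (u ∷ k ∷ n ∷ t ∷ [])

    cubicGaussSum-*cube : ∀ u c → InvertibleMod N c → cubicGaussSum (u ℤ.* (c ℤ.* c ℤ.* c)) ≈ cubicGaussSum u
    cubicGaussSum-*cube u c c-inv = begin
      cubicGaussSum (u ℤ.* (c ℤ.* c ℤ.* c))               ≈⟨ sumFin-cong N (λ y → e-cong (scale u c (+ toℕ y))) ⟩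
      sumFin R N (λ y → f (c ℤ.* + toℕ y ℤ.+ + 0))          ≈⟨ sumFin-affine N f-periodic c c-inv (+ 0) ⟩
      cubicGaussSum u                                     ∎
      where
      f : ℤ → Carrier
      f t = e R N ζ (u ℤ.* (t ℤ.* t ℤ.* t))
      scale : ∀ u c y → u ℤ.* (c ℤ.* c ℤ.* c) ℤ.* (y ℤ.* y ℤ.* y)
                        ≡ u ℤ.* ((c ℤ.* y ℤ.+ + 0) ℤ.* (c ℤ.* y ℤ.+ + 0) ℤ.* (c ℤ.* y ℤ.+ + 0))
      scale u c y = solve (u ∷ c ∷ y ∷ [])
      expand : ∀ u t k n → u ℤ.* ((t ℤ.+ k ℤ.* n) ℤ.* (t ℤ.+ k ℤ.* n) ℤ.* (t ℤ.+ k ℤ.* n))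
        ≡ u ℤ.* (t ℤ.* t ℤ.* t)
          ℤ.+ u ℤ.* k ℤ.* (+ 3 ℤ.* t ℤ.* t ℤ.+ + 3 ℤ.* t ℤ.* k ℤ.* n ℤ.+ k ℤ.* k ℤ.* n ℤ.* n) ℤ.* n
      expand u t k n = solve (u ∷ t ∷ k ∷ n ∷ [])
      f-periodic : Periodic N f
      f-periodic t k = trans (e-cong (expand u t k (+ N))) (e-periodic (u ℤ.* (t ℤ.* t ℤ.* t))
        (u ℤ.* k ℤ.* (+ 3 ℤ.* t ℤ.* t ℤ.+ + 3 ℤ.* t ℤ.* k ℤ.* + N ℤ.+ k ℤ.* k ℤ.* + N ℤ.* + N)))

    Σe[u*Fₐ]≈cubicGaussSum³*e[-u*a] : ∀ a u →
      (sumFin R N λ y₁ → sumFin R N λ y₂ → sumFin R N λ y₃ → e R N ζ (u ℤ.* F a (+ toℕ y₁) (+ toℕ y₂) (+ toℕ y₃)))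
      ≈ cubicGaussSum u * cubicGaussSum u * cubicGaussSum u * e R N ζ (u ℤ.* ℤ.- a)
    Σe[u*Fₐ]≈cubicGaussSum³*e[-u*a] a u = begin
      (sumFin R N λ y₁ → sumFin R N λ y₂ → sumFin R N λ y₃ → e R N ζ (u ℤ.* F a (+ toℕ y₁) (+ toℕ y₂) (+ toℕ y₃)))
        ≈⟨ sumFin-cong N (λ y₁ → sumFin-cong N (λ y₂ → sumFin-cong N (λ y₃ → split (+ toℕ y₁) (+ toℕ y₂) (+ toℕ y₃)))) ⟩
      (sumFin R N λ y₁ → sumFin R N λ y₂ → sumFin R N λ y₃ → f (+ toℕ y₁) * f (+ toℕ y₂) * (f (+ toℕ y₃) * e[-ua]))
        ≈⟨ sumFin³-* N _ _ _ ⟩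
      cubicGaussSum u * cubicGaussSum u * sumFin R N (λ y₃ → f (+ toℕ y₃) * e[-ua])
        ≈⟨ *-congˡ (sumFin-distribʳ N _ e[-ua]) ⟩
      cubicGaussSum u * cubicGaussSum u * (cubicGaussSum u * e[-ua])
        ≈⟨ *-assoc _ _ _ ⟨
      cubicGaussSum u * cubicGaussSum u * cubicGaussSum u * e[-ua] ∎
      where
      u*cube : ℤ → ℤ
      u*cube t = u ℤ.* (t ℤ.* t ℤ.* t)
      f : ℤ → Carrier
      f t = e R N ζ (u*cube t)
      e[-ua] : Carrier
      e[-ua] = e R N ζ (u ℤ.* ℤ.- a)
      distribute : ∀ u a y₁ y₂ y₃ → u ℤ.* (y₁ ℤ.* y₁ ℤ.* y₁ ℤ.+ y₂ ℤ.* y₂ ℤ.* y₂ ℤ.+ y₃ ℤ.* y₃ ℤ.* y₃ ℤ.- a) ≡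
        (u ℤ.* (y₁ ℤ.* y₁ ℤ.* y₁) ℤ.+ u ℤ.* (y₂ ℤ.* y₂ ℤ.* y₂)) ℤ.+ (u ℤ.* (y₃ ℤ.* y₃ ℤ.* y₃) ℤ.+ u ℤ.* ℤ.- a)
      distribute u a y₁ y₂ y₃ = solve (u ∷ a ∷ y₁ ∷ y₂ ∷ y₃ ∷ [])
      split : ∀ y₁ y₂ y₃ → e R N ζ (u ℤ.* F a y₁ y₂ y₃) ≈ f y₁ * f y₂ * (f y₃ * e[-ua])
      split y₁ y₂ y₃ = trans (e-cong (distribute u a y₁ y₂ y₃))
        (trans (e-homo (u*cube y₁ ℤ.+ u*cube y₂) (u*cube y₃ ℤ.+ u ℤ.* ℤ.- a))
               (*-cong (e-homo (u*cube y₁) (u*cube y₂)) (e-homo (u*cube y₃) (u ℤ.* ℤ.- a))))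

  module Vanishing (dom : IsDomain R) {p : ℕ} (pr : Prime p) (k : ℕ) (a : ℤ) (ζ : Carrier)
                   (ζ-primitive : IsPrimitivePrimePowerRoot R p (suc k) ζ) where

    N : ℕ
    N = p ℕ.^ suc k

    instance
      N≢0 : NonZero N
      N≢0 = ℕ.m^n≢0 p (suc k) {{prime⇒nonZero pr}}

    open Character N ζ (proj₁ ζ-primitive)

    ShiftInvariant : ℕ → Set ℓ
    ShiftInvariant j = ∀ u w → ¬ (+ p ℤ∣.∣ u) → cubicGaussSum (u ℤ.+ + (p ℕ.^ j) ℤ.* w) ≈ cubicGaussSum u

    shiftInvariant-≥ : ∀ i → ShiftInvariant (suc k ℕ.+ i)
    shiftInvariant-≥ i u w _ = trans (reflexive (≡.cong cubicGaussSum (≡.cong (ℤ._+_ u) p^[1+k+i]w≡p^iwN)))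
                                     (cubicGaussSum-periodic u (+ (p ℕ.^ i) ℤ.* w))
      where
      p^[1+k+i]w≡p^iwN : + (p ℕ.^ (suc k ℕ.+ i)) ℤ.* w ≡ + (p ℕ.^ i) ℤ.* w ℤ.* + N
      p^[1+k+i]w≡p^iwN = ≡.trans (≡.cong (λ z → + z ℤ.* w) (ℕ.^-distribˡ-+-* p (suc k) i))
                          (≡.trans (≡.cong (ℤ._* w) (ℤ.pos-* N (p ℕ.^ i))) (rotate (+ N) (+ (p ℕ.^ i)) w))
        where
        rotate : ∀ x y z → x ℤ.* y ℤ.* z ≡ y ℤ.* z ℤ.* x
        rotate x y z = solve (x ∷ y ∷ z ∷ [])

    p∣p^ : ∀ {j} → 1 ℕ.≤ j → + p ℤ∣.∣ + (p ℕ.^ j)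
    p∣p^ {suc i} _ = ℤ∣.∣ᵤ⇒∣ (ℕ.m∣m*n (p ℕ.^ i))

    p∣*N : ∀ j → + p ℤ∣.∣ j ℤ.* + N
    p∣*N j = ℤ∣.∣n⇒∣m*n j (p∣p^ {suc k} (ℕ.s≤s ℕ.z≤n))

    summand : ℤ → Carrier
    summand t with + p ℤ∣.∣? t
    ... | yes _ = 0#
    ... | no  _ = cubicGaussSum t * cubicGaussSum t * cubicGaussSum t * e R N ζ (t ℤ.* ℤ.- a)

    T-summand : Fin N → Carrier
    T-summand = summandOf (≡.refl {x = T R N ζ a})

    T≈Σsummand : T R N ζ a ≈ sumFin R N (λ u → summand (+ toℕ u))
    T≈Σsummand = sumFin-cong N term≈summand
      where
      term≈summand : ∀ u → T-summand u ≈ summand (+ toℕ u)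
      term≈summand u with coprime? (toℕ u) N | + p ℤ∣.∣? + toℕ u
      ... | yes u⊥N | yes p∣u =
        ⊥-elim (ℕ.nonTrivial⇒≢1 {{prime⇒nonTrivial pr}} (u⊥N (ℤ∣.∣⇒∣ᵤ p∣u , ℕ.m∣m*n (p ℕ.^ k))))
      ... | yes _   | no _    = Σe[u*Fₐ]≈cubicGaussSum³*e[-u*a] a (+ toℕ u)
      ... | no _    | yes _   = refl
      ... | no ¬u⊥N | no ¬p∣u = ⊥-elim (¬u⊥N (¬∣⇒coprime-^ pr (suc k) (λ p∣u → ¬p∣u (ℤ∣.∣ᵤ⇒∣ p∣u))))

    summand-periodic : Periodic N summand
    summand-periodic t j with + p ℤ∣.∣? (t ℤ.+ j ℤ.* + N) | + p ℤ∣.∣? t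
    ... | yes _      | yes _   = refl
    ... | yes p∣t+jN | no ¬p∣t = ⊥-elim (¬p∣t (ℤ∣.∣m+n∣n⇒∣m p∣t+jN (p∣*N j)))
    ... | no ¬p∣t+jN | yes p∣t = ⊥-elim (¬p∣t+jN (ℤ∣.∣m∣n⇒∣m+n p∣t (p∣*N j)))
    ... | no _       | no _    = *-cong (*-cong (*-cong g-per g-per) g-per)
                                       (trans (e-cong (expand t j (+ N) a)) (e-periodic (t ℤ.* ℤ.- a) (j ℤ.* ℤ.- a)))
      where
      g-per : cubicGaussSum (t ℤ.+ j ℤ.* + N) ≈ cubicGaussSum t
      g-per = cubicGaussSum-periodic t j
      expand : ∀ t j n a → (t ℤ.+ j ℤ.* n) ℤ.* ℤ.- a ≡ t ℤ.* ℤ.- a ℤ.+ j ℤ.* ℤ.- a ℤ.* n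
      expand t j n a = solve (t ∷ j ∷ n ∷ a ∷ [])

    module _ {m : ℕ} (1≤m : 1 ℕ.≤ m) (lifts : CubesLiftFrom p m) where

      shiftInvariant-step : ∀ j → m ℕ.≤ j → ShiftInvariant (suc j) → ShiftInvariant j
      shiftInvariant-step j m≤j invariant[1+j] u w ¬p∣u with lifts j m≤j u w ¬p∣u
      ... | x , Q , u*c³≡v+p^[1+j]Q = begin
        cubicGaussSum v                                                    ≈⟨ invariant[1+j] v Q ¬p∣v ⟨
        cubicGaussSum (v ℤ.+ + (p ℕ.^ suc j) ℤ.* Q)                         ≡⟨ ≡.cong cubicGaussSum u*c³≡v+p^[1+j]Q ⟨
        cubicGaussSum (u ℤ.* ((+ 1 ℤ.+ + p ℤ.* x) ℤ.* (+ 1 ℤ.+ + p ℤ.* x) ℤ.* (+ 1 ℤ.+ + p ℤ.* x)))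
          ≈⟨ cubicGaussSum-*cube u (+ 1 ℤ.+ + p ℤ.* x) (¬∣⇒invertibleMod-p^ pr k (¬∣1+p* pr x)) ⟩
        cubicGaussSum u                                                    ∎
        where
        v : ℤ
        v = u ℤ.+ + (p ℕ.^ j) ℤ.* w
        ¬p∣v : ¬ (+ p ℤ∣.∣ v)
        ¬p∣v p∣v = ¬p∣u (ℤ∣.∣m+n∣n⇒∣m p∣v (ℤ∣.∣m⇒∣m*n w (p∣p^ (ℕ.≤-trans 1≤m m≤j))))

      shiftInvariant : ShiftInvariant m
      shiftInvariant = descend (suc k) m ℕ.≤-refl (ℕ.m≤m+n (suc k) m)
        where
        descend : ∀ d j → m ℕ.≤ j → suc k ℕ.≤ d ℕ.+ j → ShiftInvariant j
        descend zero    j _ 1+k≤j with ℕ.m≤n⇒∃[o]m+o≡n 1+k≤j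
        ... | i , ≡.refl = shiftInvariant-≥ i
        descend (suc d) j m≤j 1+k≤1+d+j = shiftInvariant-step j m≤j
          (descend d (suc j) (ℕ.m≤n⇒m≤1+n m≤j) (≡.subst (suc k ℕ.≤_) (≡.sym (ℕ.+-suc d j)) 1+k≤1+d+j))

      P : ℤ
      P = + (p ℕ.^ m)

      ξ : Carrier
      ξ = e R N ζ (P ℤ.* ℤ.- a)

      summand-shift : ∀ t → summand (t ℤ.+ P) ≈ summand t * ξ
      summand-shift t with + p ℤ∣.∣? (t ℤ.+ P) | + p ℤ∣.∣? t
      ... | yes _     | yes _   = sym (zeroˡ ξ)
      ... | yes p∣t+P | no ¬p∣t = ⊥-elim (¬p∣t (ℤ∣.∣m+n∣n⇒∣m p∣t+P (p∣p^ 1≤m)))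
      ... | no ¬p∣t+P | yes p∣t = ⊥-elim (¬p∣t+P (ℤ∣.∣m∣n⇒∣m+n p∣t (p∣p^ 1≤m)))
      ... | no _      | no ¬p∣t = begin
        g (t ℤ.+ P) * g (t ℤ.+ P) * g (t ℤ.+ P) * e R N ζ ((t ℤ.+ P) ℤ.* ℤ.- a)
          ≈⟨ *-cong (*-cong (*-cong g-shift g-shift) g-shift)
                    (trans (e-cong (ℤ.*-distribʳ-+ (ℤ.- a) t P)) (e-homo (t ℤ.* ℤ.- a) (P ℤ.* ℤ.- a))) ⟩
        g t * g t * g t * (e R N ζ (t ℤ.* ℤ.- a) * ξ)
          ≈⟨ *-assoc _ _ _ ⟨
        g t * g t * g t * e R N ζ (t ℤ.* ℤ.- a) * ξ ∎
        where
        g : ℤ → Carrier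
        g = cubicGaussSum
        g-shift : g (t ℤ.+ P) ≈ g t
        g-shift = trans (reflexive (≡.cong (λ z → g (t ℤ.+ z)) (≡.sym (ℤ.*-identityʳ P))))
                        (shiftInvariant t (+ 1) ¬p∣t)

      Σsummand≈Σsummand*ξ : sumFin R N (λ u → summand (+ toℕ u)) ≈ sumFin R N (λ u → summand (+ toℕ u)) * ξ
      Σsummand≈Σsummand*ξ = begin
        sumFin R N (λ u → summand (+ toℕ u))
          ≈⟨ sumFin-affine N summand-periodic (+ 1) (+ 1 , + 0 , ≡.refl) P ⟨
        sumFin R N (λ u → summand (+ 1 ℤ.* + toℕ u ℤ.+ P))
          ≈⟨ sumFin-cong N (λ u → trans (reflexive (≡.cong (λ x → summand (x ℤ.+ P)) (ℤ.*-identityˡ (+ toℕ u))))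
                                         (summand-shift (+ toℕ u))) ⟩
        sumFin R N (λ u → summand (+ toℕ u) * ξ)
          ≈⟨ sumFin-distribʳ N _ ξ ⟩
        sumFin R N (λ u → summand (+ toℕ u)) * ξ ∎

      ξ≈1⇒p^k∣3a : p ℕ.^ m ℕ.∣ 3 ℕ.* p → ξ ≈ 1# → p ℕ.^ k ℕ.∣ 3 ℕ.* ℤ.∣ a ∣
      ξ≈1⇒p^k∣3a p^m∣3p ξ≈1 = p^[1+k]∣p^m*a⇒p^k∣3*a pr k m ℤ.∣ a ∣ p^m∣3p (≡.subst (N ℕ.∣_) ∣P*-a∣≡p^m∣a∣ N∣∣P*-a∣)
        where
        N∣∣P*-a∣ : N ℕ.∣ ℤ.∣ P ℤ.* ℤ.- a ∣
        N∣∣P*-a∣ = ℤ∣.∣⇒∣ᵤ (Residue.∣%ℕ⇒∣ N {t = P ℤ.* ℤ.- a} ℕ.∣-refl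
                     (^≈1⇒p^[1+k]∣ {k = k} {n = (P ℤ.* ℤ.- a) %ℕ N} pr (proj₁ ζ-primitive) (proj₂ ζ-primitive) ξ≈1))
        ∣P*-a∣≡p^m∣a∣ : ℤ.∣ P ℤ.* ℤ.- a ∣ ≡ p ℕ.^ m ℕ.* ℤ.∣ a ∣
        ∣P*-a∣≡p^m∣a∣ = ≡.trans (ℤ.abs-* P (ℤ.- a)) (≡.cong (p ℕ.^ m ℕ.*_) (ℤ.∣-i∣≡∣i∣ a))

      vanishes : p ℕ.^ m ℕ.∣ 3 ℕ.* p → ¬ p ℕ.^ k ℕ.∣ 3 ℕ.* ℤ.∣ a ∣ → T R N ζ a ≈ 0#
      vanishes p^m∣3p ¬p^k∣3a = Sum.[ trans T≈Σsummand , (λ ξ≈1 → ⊥-elim (¬p^k∣3a (ξ≈1⇒p^k∣3a p^m∣3p ξ≈1))) ]′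
        (x≈x*y⇒x≈0⊎y≈1 dom Σsummand≈Σsummand*ξ)

    T≈0 : ¬ p ℕ.^ k ℕ.∣ 3 ℕ.* ℤ.∣ a ∣ → T R N ζ a ≈ 0#
    T≈0 = let m , 1≤m , lifts , p^m∣3p = liftingExponent pr in vanishes 1≤m lifts p^m∣3p

open import Data.Nat using (_≤_; _^_; _∸_)
open import Data.Nat.Properties using (m^n≢0)
open import Data.Integer using (_*_)
open import Data.Integer.Divisibility using (_∣_)

proposition3p3 : ∀ {c ℓ : Level} (R : CommutativeRing c ℓ) → IsDomain R → CharZero R →
    (p l : ℕ) (a : ℤ) (ζ : CommutativeRing.Carrier R) (pr : Prime p) → 2 ≤ l →
    IsPrimitivePrimePowerRoot R p l ζ →
    ¬ (+ (p ^ (l ∸ 1)) ∣ (+ 3 * a)) →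
    CommutativeRing._≈_ R (T R (p ^ l) {{m^n≢0 p l {{prime⇒nonZero pr}}}} ζ a) (CommutativeRing.0# R)
proposition3p3 R dom _ p (suc k) a ζ pr (ℕ.s≤s _) ζ-primitive ¬p^k∣3a =
  Vanishing.T≈0 R dom pr k a ζ ζ-primitive
    (λ p^k∣3∣a∣ → ¬p^k∣3a (≡.subst (_ ℕ.∣_) (≡.sym (ℤ.abs-* (+ 3) a)) p^k∣3∣a∣))
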